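{- Let $n\in\mathbb{N}$ and let $a_1,\dots,a_m$ be distinct divisors of $n$. Suppose that for each pair $1\le i<j\le m$ one of the two indices $i,j$ is (arbitrarily) chosen and "assigned" the pair. For each $1\le i\le m$ define $$\mathrm{ch}(a_i)=\operatorname{lcm}\Big(\{1\}\cup\{\gcd(a_i,a_j): j\ne i,\ \text{the pair }\{i,j\}\text{ is assigned to }i\}\Big),$$ and let $H_i=\bigcup_{r=0}^{\mathrm{ch}(a_i)-1}(r+a_i\mathbb{Z}_n)$. Then $\{H_1,\dots,H_m\}$ is a non-disjoint $\big(n,m,\frac{n}{a_1}\mathrm{ch}(a_1),\dots,\frac{n}{a_m}\mathrm{ch}(a_m)\big)$-GPSEDF in $\mathbb{Z}_n$ with $\lambda_{i,j}=\frac{n}{a_ia_j}\mathrm{ch}(a_i)\mathrm{ch}(a_j)$ for $i\ne j$.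
   Context: For a divisor $a$ of $n$, $a\mathbb{Z}_n=\{0,a,2a,\dots,n-a\}$ denotes the additive subgroup of $\mathbb{Z}_n$ generated by $a$, and $r+S=\{r+s:s\in S\}$. (The quantity $\mathrm{ch}(a_i)$ is equivalently the final value of $\mathrm{chunk}(a_i)$ in the procedure: initialise $\mathrm{chunk}(a_i)=1$ for all $i$; for each pair $i<j$, choose $k\in\{i,j\}$ arbitrarily and set $\mathrm{chunk}(a_k):=\operatorname{lcm}(\mathrm{chunk}(a_k),\gcd(a_i,a_j))$.) For subsets $A,B$ of $\mathbb{Z}_n$, $\Delta(A,B)$ denotes the multiset $\{x-y:x\in A,y\in B\}$ (one entry per pair). A family of sets $\{A_1,\dots,A_m\}$ in $\mathbb{Z}_n$ with $|A_i|=k_i$ is a non-disjoint $(n,m,k_1,\dots,k_m)$-GPSEDF if for all $i\ne j$, $\Delta(A_i,A_j)$ contains every element of $\mathbb{Z}_n$ exactly $\lambda_{i,j}=k_ik_j/n$ times. -}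

module Defs where

open import Data.Nat using (ℕ; zero; suc; _+_; _*_; _∸_; _%_; _<ᵇ_; _≡ᵇ_; NonZero)
open import Data.Nat.GCD using (gcd)
open import Data.Nat.LCM using (lcm)
open import Data.Bool using (Bool; true; false; _∧_; _∨_; not; if_then_else_)
open import Data.Fin using (Fin; toℕ)
open import Data.List using (List; []; _∷_; upTo; allFin; foldr)
open import Data.Product using (_×_)
open import Relation.Binary.PropositionalEquality using (_≡_; _≢_)

countB : {A : Set} → (A → Bool) → List A → ℕ
countB p []       = 0
countB p (x ∷ xs) = if p x then suc (countB p xs) else countB p xs

anyB : {A : Set} → (A → Bool) → List A → Bool
anyB p []       = false
anyB p (x ∷ xs) = p x ∨ anyB p xs

-- Subsets of ℤ_n are boolean predicates on Fin n (Fin n = {0,…,n-1} = ℤ_n).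
ZSet : ℕ → Set
ZSet n = Fin n → Bool

card : {n : ℕ} → ZSet n → ℕ
card {n} A = countB A (allFin n)

-- multiplicity of z in the multiset Δ(A,B) = {x - y : x ∈ A, y ∈ B}
-- (x - y computed mod n as (x + (n - y)) mod n)
Δcount : (n : ℕ) .{{_ : NonZero n}} → ZSet n → ZSet n → Fin n → ℕ
Δcount n A B z =
  sumL (λ x → countB (λ y → A x ∧ B y ∧ (((toℕ x + (n ∸ toℕ y)) % n) ≡ᵇ toℕ z)) (allFin n)) (allFin n)
  where
    sumL : {X : Set} → (X → ℕ) → List X → ℕ
    sumL f []       = 0
    sumL f (x ∷ xs) = f x + sumL f xs

-- Non-disjoint (n, m, k_1, …, k_m)-GPSEDF: |A_i| = k_i, and for i ≠ j every
-- element of ℤ_n occurs exactly λ_{i,j} = k_i k_j / n times in Δ(A_i,A_j)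
-- (stated division-free as  multiplicity * n ≡ k_i * k_j).
IsGPSEDF : (n m : ℕ) .{{_ : NonZero n}} → (Fin m → ZSet n) → (Fin m → ℕ) → Set
IsGPSEDF n m A k =
  (∀ i → card (A i) ≡ k i) ×
  (∀ i j → i ≢ j → ∀ z → Δcount n (A i) (A j) z * n ≡ k i * k j)

-- Assignment of pairs: for toℕ i < toℕ j, the pair {i,j} is assigned to i
-- if  σ i j ≡ true  and to j if  σ i j ≡ false  (σ on other arguments is ignored).
assignedTo : {m : ℕ} → (Fin m → Fin m → Bool) → Fin m → Fin m → Bool
assignedTo σ i j =
  ((toℕ i <ᵇ toℕ j) ∧ σ i j) ∨ ((toℕ j <ᵇ toℕ i) ∧ not (σ j i))

ch : {m : ℕ} → (Fin m → ℕ) → (Fin m → Fin m → Bool) → Fin m → ℕ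
ch {m} a σ i =
  foldr (λ j acc → if assignedTo σ i j then lcm (gcd (a i) (a j)) acc else acc) 1 (allFin m)

H : (n : ℕ) .{{_ : NonZero n}} → (a c : ℕ) → ZSet n
H n a c x = anyB (λ r → anyB (λ t → ((r + t * a) % n) ≡ᵇ toℕ x) (upTo n)) (upTo c)

{-# OPTIONS --safe #-}
module Submission where

-- Membership of x in H = ⋃_{r<c} (r + aℤ_n) only asks that x mod a be below c, so |H| = (n/a)c.
-- For i ≠ j the pair {i,j} is assigned to one index, say i, so that g = gcd(a_i, a_j) divides
-- c_i = ch(a_i).  By Bézout some multiple of a_j is ≡ g (mod a_i); rotating ℤ_n by it fixes
-- every translate of H_j and shifts residues mod a_i by g, so the number of points of such a
-- translate with residue u mod a_i is g-periodic in u.  A window of c_i residues is c_i/g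
-- periods, so it catches the fraction c_i/a_i of the (n/a_j)c_j points of the translate: every
-- z occurs n c_i c_j/(a_i a_j) times in Δ(H_i, H_j).

open import Defs
open import Data.Bool using (Bool; true; false; _∧_; _∨_; T; not; if_then_else_)
open import Data.Bool.ListAction using (any)
open import Data.Bool.Properties using (∧-assoc; ∧-comm)
open import Data.Empty using (⊥-elim)
open import Data.Fin as Fin using (Fin; toℕ)
open import Data.Fin.Properties using (toℕ<n; toℕ-injective)
open import Data.List as List using (List; []; _∷_; allFin; tabulate; upTo)
open import Data.List.Membership.Propositional using (_∈_)
open import Data.List.Membership.Propositional.Properties using (∈-allFin)
open import Data.List.Relation.Unary.Any using (here; there)
open import Data.List.Relation.Unary.Any.Properties using (any⁺; any⁻; applyUpTo⁺; applyUpTo⁻)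
open import Data.Nat
open import Data.Nat.DivMod
open import Data.Nat.Divisibility
open import Data.Nat.GCD using (gcd; gcd-GCD; gcd[m,n]∣m; gcd-comm; module Bézout)
open import Data.Nat.LCM using (lcm; lcm-least; m∣lcm[m,n]; n∣lcm[m,n])
open import Data.Nat.ListAction using () renaming (sum to listSum)
open import Data.Nat.Properties
open import Data.Nat.Solver using (module +-*-Solver)
open import Data.Product using (∃-syntax; _×_; _,_; proj₁; proj₂)
open import Data.Sum using (_⊎_; inj₁; inj₂; [_,_]; swap)
open import Function.Base using (_∘_; id)
open import Function.Definitions using (Injective)
open import Relation.Binary.Definitions using (tri<; tri≈; tri>)
open import Relation.Binary.PropositionalEquality using (_≡_; _≢_; refl; sym; trans; cong; cong₂; subst; module ≡-Reasoning)
open import Relation.Nullary.Decidable using (dec-true; dec-false)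
open import Relation.Nullary.Negation using (contradiction)
open import Algebra.Properties.CommutativeMonoid.Sum +-0-commutativeMonoid
  using (sum; sum-cong-≗; sum-replicate-zero; ∑-comm)
open import Algebra.Properties.CommutativeSemigroup +-commutativeSemigroup using (xy∙z≈xz∙y)
open +-*-Solver using (solve; _:=_; _:+_; _:*_; con)
open ≡-Reasoning

-- Sums and counts over initial segments of ℕ

∑< : ℕ → (ℕ → ℕ) → ℕ
∑< zero    f = 0
∑< (suc N) f = f 0 + ∑< N (f ∘ suc)

syntax ∑< N (λ k → e) = ∑[ k < N ] e

𝟙 : Bool → ℕ
𝟙 true  = 1
𝟙 false = 0

#< : ℕ → (ℕ → Bool) → ℕ
#< N P = ∑[ k < N ] 𝟙 (P k)

syntax #< N (λ k → P) = #[ k < N ] P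

∑-cong : ∀ N {f g : ℕ → ℕ} → (∀ k → k < N → f k ≡ g k) → ∑< N f ≡ ∑< N g
∑-cong zero    f≡g = refl
∑-cong (suc N) f≡g = cong₂ _+_ (f≡g 0 z<s) (∑-cong N (λ k k<N → f≡g (suc k) (s<s k<N)))

∑≡sum : ∀ N (f : ℕ → ℕ) → ∑< N f ≡ sum {N} (f ∘ toℕ)
∑≡sum zero    f = refl
∑≡sum (suc N) f = cong (f 0 +_) (∑≡sum N (f ∘ suc))

∑-zero : ∀ N → ∑[ k < N ] 0 ≡ 0
∑-zero N = trans (∑≡sum N _) (sum-replicate-zero N)

∑-swap : ∀ M N (f : ℕ → ℕ → ℕ) → ∑[ x < M ] ∑[ y < N ] f x y ≡ ∑[ y < N ] ∑[ x < M ] f x y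
∑-swap M N f = begin
  ∑[ x < M ] ∑[ y < N ] f x y                   ≡⟨ nested M N f ⟩
  sum {M} (λ i → sum {N} (λ j → f (toℕ i) (toℕ j))) ≡⟨ ∑-comm {M} {N} (λ i j → f (toℕ i) (toℕ j)) ⟩
  sum {N} (λ j → sum {M} (λ i → f (toℕ i) (toℕ j))) ≡⟨ nested N M (λ y x → f x y) ⟨
  ∑[ y < N ] ∑[ x < M ] f x y                   ∎
  where
  nested : ∀ M N (f : ℕ → ℕ → ℕ) → ∑[ x < M ] ∑[ y < N ] f x y ≡ sum {M} (λ i → sum {N} (λ j → f (toℕ i) (toℕ j)))
  nested M N f = trans (∑≡sum M _) (sum-cong-≗ {M} (λ i → ∑≡sum N (f (toℕ i))))

∑-split : ∀ M K (f : ℕ → ℕ) → ∑< (M + K) f ≡ ∑< M f + ∑[ k < K ] f (M + k)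
∑-split zero    K f = refl
∑-split (suc M) K f = trans (cong (f 0 +_) (∑-split M K (f ∘ suc))) (sym (+-assoc (f 0) _ _))

∑-indicator-≡ᵇ : ∀ N v (P : ℕ → Bool) → ∑[ x < N ] 𝟙 ((v ≡ᵇ x) ∧ P x) ≡ 𝟙 ((v <ᵇ N) ∧ P v)
∑-indicator-≡ᵇ zero    v       P = refl
∑-indicator-≡ᵇ (suc N) zero    P = trans (cong (𝟙 (P 0) +_) (∑-zero N)) (+-identityʳ _)
∑-indicator-≡ᵇ (suc N) (suc v) P = ∑-indicator-≡ᵇ N v (P ∘ suc)

#-below : ∀ {d N} → d ≤ N → #[ t < N ] (t <ᵇ d) ≡ d
#-below {zero}  {N}     _         = ∑-zero N
#-below {suc d} {suc N} (s≤s d≤N) = cong suc (#-below d≤N)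

∑-periodic : ∀ q a .{{_ : NonZero a}} (f : ℕ → ℕ) → ∑[ t < q * a ] f (t % a) ≡ q * ∑< a f
∑-periodic zero    a f = refl
∑-periodic (suc q) a f = begin
  ∑[ t < a + q * a ] f (t % a)                      ≡⟨ ∑-split a (q * a) _ ⟩
  ∑[ t < a ] f (t % a) + ∑[ k < q * a ] f ((a + k) % a) ≡⟨ cong₂ _+_ (∑-cong a (λ t t<a → cong f (m<n⇒m%n≡m t<a)))
                                                              (trans (∑-cong (q * a) (λ k _ → cong f (%-remove-+ˡ k ∣-refl)))
                                                                     (∑-periodic q a f)) ⟩
  ∑< a f + q * ∑< a f                               ∎

∑-periodic-prefix : ∀ {p L} (f : ℕ → ℕ) → (∀ u → u + p < L → f (p + u) ≡ f u) →
                    ∀ k → k * p ≤ L → ∑< (k * p) f ≡ k * ∑< p f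
∑-periodic-prefix         f periodic zero    _      = refl
∑-periodic-prefix {p} {L} f periodic (suc k) kp+p≤L = begin
  ∑< (p + k * p) f                       ≡⟨ ∑-split p (k * p) f ⟩
  ∑< p f + ∑[ u < k * p ] f (p + u)      ≡⟨ cong (∑< p f +_) (∑-cong (k * p) (λ u u<kp → periodic u (shifted-bound u<kp))) ⟩
  ∑< p f + ∑< (k * p) f                  ≡⟨ cong (∑< p f +_) (∑-periodic-prefix f periodic k kp≤L) ⟩
  ∑< p f + k * ∑< p f                    ∎
  where
  kp≤L : k * p ≤ L
  kp≤L = ≤-trans (m≤n+m (k * p) p) kp+p≤L
  shifted-bound : ∀ {u} → u < k * p → u + p < L
  shifted-bound {u} u<kp = <-≤-trans (subst (u + p <_) (+-comm (k * p) p) (+-monoˡ-< p u<kp)) kp+p≤L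

-- Modular arithmetic

T-ext : ∀ {x y} → (T x → T y) → (T y → T x) → x ≡ y
T-ext {false} {false} _    _    = refl
T-ext {false} {true}  _    y⇒x = ⊥-elim (y⇒x _)
T-ext {true}  {false} x⇒y _    = ⊥-elim (x⇒y _)
T-ext {true}  {true}  _    _    = refl

≡ᵇ-cong : ∀ {m n p q} → (m ≡ n → p ≡ q) → (p ≡ q → m ≡ n) → (m ≡ᵇ n) ≡ (p ≡ᵇ q)
≡ᵇ-cong {m} {n} {p} {q} to from =
  T-ext (≡⇒≡ᵇ p q ∘ to ∘ ≡ᵇ⇒≡ m n) (≡⇒≡ᵇ m n ∘ from ∘ ≡ᵇ⇒≡ p q)

[m%n+k]%d≡[m+k]%d : ∀ m k {n d} .{{_ : NonZero n}} .{{_ : NonZero d}} → d ∣ n → (m % n + k) % d ≡ (m + k) % d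
[m%n+k]%d≡[m+k]%d m k {n} {d} d∣n = begin
  (m % n + k) % d             ≡⟨ %-distribˡ-+ (m % n) k d ⟩
  (m % n % d + k % d) % d     ≡⟨ cong (λ t → (t + k % d) % d) (m∣n⇒o%n%m≡o%m d n m d∣n) ⟩
  (m % d + k % d) % d         ≡⟨ %-distribˡ-+ m k d ⟨
  (m + k) % d                 ∎

%-cancelʳ-+ : ∀ m n k {d} .{{_ : NonZero d}} → (m + k) % d ≡ (n + k) % d → m % d ≡ n % d
%-cancelʳ-+ m n k {d@(suc d′)} eq = begin
  m % d                           ≡⟨ undo-shift m ⟩
  ((m + k) % d + k * d′) % d      ≡⟨ cong (λ t → (t + k * d′) % d) eq ⟩
  ((n + k) % d + k * d′) % d      ≡⟨ undo-shift n ⟨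
  n % d                           ∎
  where
  undo-shift : ∀ x → x % d ≡ ((x + k) % d + k * d′) % d
  undo-shift x = begin
    x % d                         ≡⟨ [m+kn]%n≡m%n x k d ⟨
    (x + k * d) % d               ≡⟨ cong (λ t → (x + t) % d) (*-suc k d′) ⟩
    (x + (k + k * d′)) % d        ≡⟨ cong (_% d) (+-assoc x k (k * d′)) ⟨
    (x + k + k * d′) % d          ≡⟨ [m%n+k]%d≡[m+k]%d (x + k) (k * d′) ∣-refl ⟨
    ((x + k) % d + k * d′) % d    ∎

shifted-residue-≡ᵇ : ∀ m {k u d} .{{_ : NonZero d}} → u + k < d → ((m + k) % d ≡ᵇ k + u) ≡ (m % d ≡ᵇ u)
shifted-residue-≡ᵇ m {k} {u} {d} u+k<d = ≡ᵇ-cong to from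
  where
  u+k-reduced : (u + k) % d ≡ k + u
  u+k-reduced = trans (m<n⇒m%n≡m u+k<d) (+-comm u k)
  to : (m + k) % d ≡ k + u → m % d ≡ u
  to eq = trans (%-cancelʳ-+ m u k (trans eq (sym u+k-reduced))) (m<n⇒m%n≡m (≤-<-trans (m≤m+n u k) u+k<d))
  from : m % d ≡ u → (m + k) % d ≡ k + u
  from eq = begin
    (m + k) % d       ≡⟨ [m%n+k]%d≡[m+k]%d m k ∣-refl ⟨
    (m % d + k) % d   ≡⟨ cong (λ t → (t + k) % d) eq ⟩
    (u + k) % d       ≡⟨ u+k-reduced ⟩
    k + u             ∎

gcd-≡-multiple : ∀ a b .{{_ : NonZero a}} → ∃[ k ] ∀ m → (m + k * b) % a ≡ (m + gcd a b) % a
gcd-≡-multiple a@(suc a′) b with gcd a b | Bézout.identity (gcd-GCD a b)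
... | g | Bézout.-+ x y g+xa≡yb = y , λ m → begin
  (m + y * b) % a          ≡⟨ cong (λ t → (m + t) % a) g+xa≡yb ⟨
  (m + (g + x * a)) % a    ≡⟨ cong (_% a) (+-assoc m g (x * a)) ⟨
  (m + g + x * a) % a      ≡⟨ [m+kn]%n≡m%n (m + g) x a ⟩
  (m + g) % a              ∎
-- Here y b ≡ -g (mod a), hence (a - 1) y b ≡ g.
... | g | Bézout.+- x y g+yb≡xa = a′ * y , λ m → begin
  (m + a′ * y * b) % a               ≡⟨ [m+kn]%n≡m%n (m + a′ * y * b) x a ⟨
  (m + a′ * y * b + x * a) % a       ≡⟨ cong (λ t → (m + a′ * y * b + t) % a) g+yb≡xa ⟨
  (m + a′ * y * b + (g + y * b)) % a ≡⟨ cong (_% a) (solve 5 (λ m a′ y b g → m :+ a′ :* y :* b :+ (g :+ y :* b)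
                                                              := m :+ g :+ (y :* b) :* (con 1 :+ a′)) refl m a′ y b g) ⟩
  (m + g + y * b * a) % a            ≡⟨ [m+kn]%n≡m%n (m + g) (y * b) a ⟩
  (m + g) % a                        ∎

difference-≡ᵇ : ∀ n .{{_ : NonZero n}} {x y z} → x < n → y < n → z < n →
                ((x + (n ∸ y)) % n ≡ᵇ z) ≡ ((z + y) % n ≡ᵇ x)
difference-≡ᵇ n {x} {y} {z} x<n y<n z<n = ≡ᵇ-cong to from
  where
  to : (x + (n ∸ y)) % n ≡ z → (z + y) % n ≡ x
  to eq = begin
    (z + y) % n                   ≡⟨ cong (λ t → (t + y) % n) eq ⟨
    ((x + (n ∸ y)) % n + y) % n   ≡⟨ [m%n+k]%d≡[m+k]%d (x + (n ∸ y)) y ∣-refl ⟩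
    (x + (n ∸ y) + y) % n         ≡⟨ cong (_% n) (trans (+-assoc x (n ∸ y) y) (cong (x +_) (m∸n+n≡m (<⇒≤ y<n)))) ⟩
    (x + n) % n                   ≡⟨ [m+n]%n≡m%n x n ⟩
    x % n                         ≡⟨ m<n⇒m%n≡m x<n ⟩
    x                             ∎
  from : (z + y) % n ≡ x → (x + (n ∸ y)) % n ≡ z
  from eq = begin
    (x + (n ∸ y)) % n             ≡⟨ cong (λ t → (t + (n ∸ y)) % n) eq ⟨
    ((z + y) % n + (n ∸ y)) % n   ≡⟨ [m%n+k]%d≡[m+k]%d (z + y) (n ∸ y) ∣-refl ⟩
    (z + y + (n ∸ y)) % n         ≡⟨ cong (_% n) (trans (+-assoc z y (n ∸ y)) (cong (z +_) (m+[n∸m]≡n (<⇒≤ y<n)))) ⟩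
    (z + n) % n                   ≡⟨ [m+n]%n≡m%n z n ⟩
    z % n                         ≡⟨ m<n⇒m%n≡m z<n ⟩
    z                             ∎

∑-rotate< : ∀ n .{{_ : NonZero n}} (f : ℕ → ℕ) {s} → s < n → ∑[ y < n ] f ((y + s) % n) ≡ ∑< n f
∑-rotate< n f {s} s<n = begin
  ∑[ y < n ] f ((y + s) % n)                                         ≡⟨ cong (λ N → ∑[ y < N ] f ((y + s) % n)) (sym n-s+s≡n) ⟩
  ∑[ y < n ∸ s + s ] f ((y + s) % n)                                 ≡⟨ ∑-split (n ∸ s) s _ ⟩
  ∑[ y < n ∸ s ] f ((y + s) % n) + ∑[ k < s ] f ((n ∸ s + k + s) % n) ≡⟨ cong₂ _+_ (∑-cong (n ∸ s) no-wrap) (∑-cong s wrap) ⟩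
  ∑[ y < n ∸ s ] f (s + y) + ∑< s f                                  ≡⟨ +-comm _ (∑< s f) ⟩
  ∑< s f + ∑[ y < n ∸ s ] f (s + y)                                  ≡⟨ ∑-split s (n ∸ s) f ⟨
  ∑< (s + (n ∸ s)) f                                                 ≡⟨ cong (λ N → ∑< N f) (m+[n∸m]≡n (<⇒≤ s<n)) ⟩
  ∑< n f                                                             ∎
  where
  n-s+s≡n : n ∸ s + s ≡ n
  n-s+s≡n = m∸n+n≡m (<⇒≤ s<n)
  no-wrap : ∀ y → y < n ∸ s → f ((y + s) % n) ≡ f (s + y)
  no-wrap y y<n-s = cong f (trans (m<n⇒m%n≡m (subst (y + s <_) n-s+s≡n (+-monoˡ-< s y<n-s))) (+-comm y s))
  wrap : ∀ k → k < s → f ((n ∸ s + k + s) % n) ≡ f k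
  wrap k k<s = cong f (begin
    (n ∸ s + k + s) % n   ≡⟨ cong (_% n) (xy∙z≈xz∙y (n ∸ s) k s) ⟩
    (n ∸ s + s + k) % n   ≡⟨ cong (λ t → (t + k) % n) n-s+s≡n ⟩
    (n + k) % n           ≡⟨ %-remove-+ˡ k ∣-refl ⟩
    k % n                 ≡⟨ m<n⇒m%n≡m (<-trans k<s s<n) ⟩
    k                     ∎)

∑-rotate : ∀ n .{{_ : NonZero n}} (f : ℕ → ℕ) s → ∑[ y < n ] f ((y + s) % n) ≡ ∑< n f
∑-rotate n f s = begin
  ∑[ y < n ] f ((y + s) % n)        ≡⟨ ∑-cong n (λ y _ → cong f (reduce y)) ⟩
  ∑[ y < n ] f ((y + s % n) % n)    ≡⟨ ∑-rotate< n f (m%n<n s n) ⟩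
  ∑< n f                            ∎
  where
  reduce : ∀ y → (y + s) % n ≡ (y + s % n) % n
  reduce y = begin
    (y + s) % n       ≡⟨ cong (_% n) (+-comm y s) ⟩
    (s + y) % n       ≡⟨ [m%n+k]%d≡[m+k]%d s y ∣-refl ⟨
    (s % n + y) % n   ≡⟨ cong (_% n) (+-comm (s % n) y) ⟩
    (y + s % n) % n   ∎

-- Windows of residues

#-window : ∀ {n a c} .{{_ : NonZero a}} (a∣n : a ∣ n) → c ≤ a → #[ x < n ] (x % a <ᵇ c) ≡ quotient a∣n * c
#-window {a = a} {c} (divides q refl) c≤a = trans (∑-periodic q a (λ t → 𝟙 (t <ᵇ c))) (cong (q *_) (#-below c≤a))

#-shifted-window : ∀ {n a c} v .{{_ : NonZero n}} .{{_ : NonZero a}} (a∣n : a ∣ n) → c ≤ a →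
                   #[ y < n ] ((y + v) % a <ᵇ c) ≡ quotient a∣n * c
#-shifted-window {n} {a} {c} v a∣n c≤a = begin
  #[ y < n ] ((y + v) % a <ᵇ c)      ≡⟨ ∑-cong n (λ y _ → cong (λ t → 𝟙 (t <ᵇ c)) (m∣n⇒o%n%m≡o%m a n (y + v) a∣n)) ⟨
  #[ y < n ] ((y + v) % n % a <ᵇ c)  ≡⟨ ∑-rotate n (λ t → 𝟙 (t % a <ᵇ c)) v ⟩
  #[ x < n ] (x % a <ᵇ c)            ≡⟨ #-window a∣n c≤a ⟩
  quotient a∣n * c                   ∎

module WindowCount {n a b : ℕ} .{{_ : NonZero n}} .{{_ : NonZero a}} (a∣n : a ∣ n) (w : ℕ)
                   (D : ℕ → Bool) (D-invariant : ∀ t s → b ∣ s → D ((t + s) % n) ≡ D t) where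

  fibre : ℕ → ℕ
  fibre u = #[ y < n ] (((y + w) % a ≡ᵇ u) ∧ D y)

  fibre-periodic : ∀ u → u + gcd a b < a → fibre (gcd a b + u) ≡ fibre u
  fibre-periodic u u+g<a = begin
    fibre (g + u)
      ≡⟨ ∑-rotate n _ (k * b) ⟨
    #[ y < n ] ((((y + k * b) % n + w) % a ≡ᵇ g + u) ∧ D ((y + k * b) % n))
      ≡⟨ ∑-cong n (λ y _ → cong 𝟙 (cong₂ _∧_ (residue y) (D-invariant y (k * b) (n∣m*n k)))) ⟩
    fibre u
      ∎
    where
    g : ℕ
    g = gcd a b
    k : ℕ
    k = proj₁ (gcd-≡-multiple a b)
    residue : ∀ y → (((y + k * b) % n + w) % a ≡ᵇ g + u) ≡ ((y + w) % a ≡ᵇ u)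
    residue y = begin
      (((y + k * b) % n + w) % a ≡ᵇ g + u) ≡⟨ cong (_≡ᵇ g + u) ([m%n+k]%d≡[m+k]%d (y + k * b) w a∣n) ⟩
      ((y + k * b + w) % a ≡ᵇ g + u)       ≡⟨ cong (λ t → t % a ≡ᵇ g + u) (xy∙z≈xz∙y y (k * b) w) ⟩
      ((y + w + k * b) % a ≡ᵇ g + u)       ≡⟨ cong (_≡ᵇ g + u) (proj₂ (gcd-≡-multiple a b) (y + w)) ⟩
      ((y + w + g) % a ≡ᵇ g + u)           ≡⟨ shifted-residue-≡ᵇ (y + w) u+g<a ⟩
      ((y + w) % a ≡ᵇ u)                   ∎

  ∑-fibres-window : ∀ c → #[ y < n ] (((y + w) % a <ᵇ c) ∧ D y) ≡ ∑< c fibre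
  ∑-fibres-window c = begin
    #[ y < n ] (((y + w) % a <ᵇ c) ∧ D y)              ≡⟨ ∑-cong n (λ y _ → ∑-indicator-≡ᵇ c ((y + w) % a) (λ _ → D y)) ⟨
    ∑[ y < n ] ∑[ u < c ] 𝟙 (((y + w) % a ≡ᵇ u) ∧ D y) ≡⟨ ∑-swap n c _ ⟩
    ∑< c fibre                                         ∎

  ∑-fibres-all : #[ y < n ] D y ≡ ∑< a fibre
  ∑-fibres-all = trans (∑-cong n (λ y _ → cong (λ t → 𝟙 (t ∧ D y)) (sym (dec-true (_ <? a) (m%n<n (y + w) a)))))
                       (∑-fibres-window a)

  count-window∧invariant : ∀ {c} → gcd a b ∣ c → c ≤ a → #[ y < n ] (((y + w) % a <ᵇ c) ∧ D y) * a ≡ c * #[ y < n ] D y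
  count-window∧invariant {c} (divides kc c≡kc*g) c≤a = begin
    #[ y < n ] (((y + w) % a <ᵇ c) ∧ D y) * a  ≡⟨ cong₂ _*_ window-sum a≡ka*g ⟩
    kc * S * (ka * g)                          ≡⟨ solve 4 (λ kc S ka g → kc :* S :* (ka :* g) := kc :* g :* (ka :* S)) refl kc S ka g ⟩
    kc * g * (ka * S)                          ≡⟨ cong₂ _*_ c≡kc*g all-sum ⟨
    c * #[ y < n ] D y                         ∎
    where
    g : ℕ
    g = gcd a b
    ka : ℕ
    ka = quotient (gcd[m,n]∣m a b)
    a≡ka*g : a ≡ ka * g
    a≡ka*g = _∣_.equality (gcd[m,n]∣m a b)
    S : ℕ
    S = ∑< g fibre
    window-sum : #[ y < n ] (((y + w) % a <ᵇ c) ∧ D y) ≡ kc * S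
    window-sum = begin
      #[ y < n ] (((y + w) % a <ᵇ c) ∧ D y) ≡⟨ ∑-fibres-window c ⟩
      ∑< c fibre                            ≡⟨ cong (λ t → ∑< t fibre) c≡kc*g ⟩
      ∑< (kc * g) fibre                     ≡⟨ ∑-periodic-prefix fibre fibre-periodic kc (subst (_≤ a) c≡kc*g c≤a) ⟩
      kc * S                                ∎
    all-sum : #[ y < n ] D y ≡ ka * S
    all-sum = begin
      #[ y < n ] D y      ≡⟨ ∑-fibres-all ⟩
      ∑< a fibre          ≡⟨ cong (λ t → ∑< t fibre) a≡ka*g ⟩
      ∑< (ka * g) fibre   ≡⟨ ∑-periodic-prefix fibre fibre-periodic ka (≤-reflexive (sym a≡ka*g)) ⟩
      ka * S              ∎

count-window∧window : ∀ {n a b c d} w v .{{_ : NonZero n}} .{{_ : NonZero a}} .{{_ : NonZero b}} →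
                      a ∣ n → b ∣ n → gcd a b ∣ c → c ≤ a → d ≤ b →
                      #[ y < n ] (((y + w) % a <ᵇ c) ∧ ((y + v) % b <ᵇ d)) * (a * b) ≡ n * c * d
count-window∧window {n} {a} {b} {c} {d} w v a∣n b∣n@(divides q n≡q*b) g∣c c≤a d≤b = begin
  count * (a * b)                        ≡⟨ *-assoc count a b ⟨
  count * a * b                          ≡⟨ cong (_* b) (count-window∧invariant g∣c c≤a) ⟩
  c * #[ y < n ] ((y + v) % b <ᵇ d) * b  ≡⟨ cong (λ t → c * t * b) (#-shifted-window v b∣n d≤b) ⟩
  c * (q * d) * b                        ≡⟨ solve 4 (λ c q d b → c :* (q :* d) :* b := q :* b :* c :* d) refl c q d b ⟩
  q * b * c * d                          ≡⟨ cong (λ t → t * c * d) n≡q*b ⟨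
  n * c * d                              ∎
  where
  count : ℕ
  count = #[ y < n ] (((y + w) % a <ᵇ c) ∧ ((y + v) % b <ᵇ d))
  invariant : ∀ t s → b ∣ s → (((t + s) % n + v) % b <ᵇ d) ≡ ((t + v) % b <ᵇ d)
  invariant t s b∣s = cong (_<ᵇ d) (begin
    ((t + s) % n + v) % b  ≡⟨ [m%n+k]%d≡[m+k]%d (t + s) v b∣n ⟩
    (t + s + v) % b        ≡⟨ cong (_% b) (xy∙z≈xz∙y t s v) ⟩
    (t + v + s) % b        ≡⟨ %-remove-+ʳ (t + v) b∣s ⟩
    (t + v) % b            ∎)
  open WindowCount a∣n w (λ y → (y + v) % b <ᵇ d) invariant

count-window∧window′ : ∀ {n a b c d} w v .{{_ : NonZero n}} .{{_ : NonZero a}} .{{_ : NonZero b}} →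
                       a ∣ n → b ∣ n → gcd a b ∣ d → c ≤ a → d ≤ b →
                       #[ y < n ] (((y + w) % a <ᵇ c) ∧ ((y + v) % b <ᵇ d)) * (a * b) ≡ n * c * d
count-window∧window′ {n} {a} {b} {c} {d} w v a∣n b∣n g∣d c≤a d≤b = begin
  #[ y < n ] (W y ∧ V y) * (a * b)  ≡⟨ cong₂ _*_ (∑-cong n (λ y _ → cong 𝟙 (∧-comm (W y) (V y)))) (*-comm a b) ⟩
  #[ y < n ] (V y ∧ W y) * (b * a)  ≡⟨ count-window∧window v w b∣n a∣n g′∣d d≤b c≤a ⟩
  n * d * c                         ≡⟨ solve 3 (λ n d c → n :* d :* c := n :* c :* d) refl n d c ⟩
  n * c * d                         ∎
  where
  W V : ℕ → Bool
  W y = (y + w) % a <ᵇ c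
  V y = (y + v) % b <ᵇ d
  g′∣d : gcd b a ∣ d
  g′∣d = subst (_∣ d) (gcd-comm a b) g∣d

-- Reading Δcount, card and H as counts

sum-map-unique : ∀ {A : Set} {f : A → ℕ} (s : List A → ℕ) → s [] ≡ 0 → (∀ x xs → s (x ∷ xs) ≡ f x + s xs) →
                 ∀ xs → s xs ≡ listSum (List.map f xs)
sum-map-unique s s[] s∷ []       = s[]
sum-map-unique s s[] s∷ (x ∷ xs) = trans (s∷ x xs) (cong (_ +_) (sum-map-unique s s[] s∷ xs))

sum-map-tabulate : ∀ {A : Set} {N} (f : A → ℕ) (g : Fin N → A) (h : ℕ → ℕ) → (∀ i → f (g i) ≡ h (toℕ i)) →
                   listSum (List.map f (tabulate g)) ≡ ∑< N h
sum-map-tabulate {N = zero}  f g h fg≗h = refl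
sum-map-tabulate {N = suc N} f g h fg≗h = cong₂ _+_ (fg≗h Fin.zero) (sum-map-tabulate f (g ∘ Fin.suc) (h ∘ suc) (fg≗h ∘ Fin.suc))

countB-∷ : ∀ {A : Set} (p : A → Bool) x xs → countB p (x ∷ xs) ≡ 𝟙 (p x) + countB p xs
countB-∷ p x xs with p x
... | true  = refl
... | false = refl

countB-allFin : ∀ {N} {p : Fin N → Bool} (P : ℕ → Bool) → (∀ i → p i ≡ P (toℕ i)) → countB p (allFin N) ≡ #[ k < N ] P k
countB-allFin {N} {p} P p≗P =
  trans (sum-map-unique (countB p) refl (countB-∷ p) (allFin N)) (sum-map-tabulate (𝟙 ∘ p) id _ (cong 𝟙 ∘ p≗P))

Δrow : (n : ℕ) .{{_ : NonZero n}} → ZSet n → ZSet n → Fin n → Fin n → ℕ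
Δrow n A B z x = countB (λ y → A x ∧ B y ∧ (((toℕ x + (n ∸ toℕ y)) % n) ≡ᵇ toℕ z)) (allFin n)

-- Δcount adds up its rows with a function local to its where-block, which cannot be named here.
-- Once the row function and then the list of rows are abstracted, that function is applied to a
-- variable, so unification can solve for it in sum-map-unique.
Δcount-as-sum : ∀ n .{{_ : NonZero n}} (A B : ZSet n) z → Δcount n A B z ≡ listSum (List.map (Δrow n A B z) (allFin n))
Δcount-as-sum n A B z with Δrow n A B z
... | _ with allFin n | sum-map-unique _ refl (λ _ _ → refl)
... | xs | by-recursion = by-recursion xs

Δcount-≡-# : ∀ {n} .{{_ : NonZero n}} {A B : ZSet n} (P Q : ℕ → Bool) →
             (∀ x → A x ≡ P (toℕ x)) → (∀ y → B y ≡ Q (toℕ y)) →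
             ∀ z → Δcount n A B z ≡ #[ y < n ] (P ((y + toℕ z) % n) ∧ Q y)
Δcount-≡-# {n} {A} {B} P Q A≗P B≗Q z = begin
  Δcount n A B z
    ≡⟨ Δcount-as-sum n A B z ⟩
  listSum (List.map (Δrow n A B z) (allFin n))
    ≡⟨ sum-map-tabulate (Δrow n A B z) id _ (λ x → countB-allFin _ (row x)) ⟩
  ∑[ x < n ] ∑[ y < n ] 𝟙 (((Z + y) % n ≡ᵇ x) ∧ (P x ∧ Q y))
    ≡⟨ ∑-swap n n _ ⟩
  ∑[ y < n ] ∑[ x < n ] 𝟙 (((Z + y) % n ≡ᵇ x) ∧ (P x ∧ Q y))
    ≡⟨ ∑-cong n (λ y _ → ∑-indicator-≡ᵇ n ((Z + y) % n) (λ x → P x ∧ Q y)) ⟩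
  ∑[ y < n ] 𝟙 (((Z + y) % n <ᵇ n) ∧ (P ((Z + y) % n) ∧ Q y))
    ≡⟨ ∑-cong n (λ y _ → cong 𝟙 (cong₂ _∧_ (dec-true (_ <? n) (m%n<n (Z + y) n))
                                           (cong (λ t → P (t % n) ∧ Q y) (+-comm Z y)))) ⟩
  #[ y < n ] (P ((y + Z) % n) ∧ Q y)
    ∎
  where
  Z : ℕ
  Z = toℕ z
  row : ∀ x y → (A x ∧ B y ∧ (((toℕ x + (n ∸ toℕ y)) % n) ≡ᵇ Z))
                ≡ (((Z + toℕ y) % n ≡ᵇ toℕ x) ∧ (P (toℕ x) ∧ Q (toℕ y)))
  row x y = begin
    A x ∧ B y ∧ difference    ≡⟨ cong₂ (λ p q → p ∧ q ∧ difference) (A≗P x) (B≗Q y) ⟩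
    Px ∧ Qy ∧ difference      ≡⟨ ∧-assoc Px Qy difference ⟨
    (Px ∧ Qy) ∧ difference    ≡⟨ ∧-comm (Px ∧ Qy) difference ⟩
    difference ∧ (Px ∧ Qy)    ≡⟨ cong (_∧ (Px ∧ Qy)) (difference-≡ᵇ n (toℕ<n x) (toℕ<n y) (toℕ<n z)) ⟩
    ((Z + toℕ y) % n ≡ᵇ toℕ x) ∧ (Px ∧ Qy)  ∎
    where
    Px Qy difference : Bool
    Px = P (toℕ x)
    Qy = Q (toℕ y)
    difference = (toℕ x + (n ∸ toℕ y)) % n ≡ᵇ Z

anyB≡any : ∀ {A : Set} (p : A → Bool) xs → anyB p xs ≡ any p xs
anyB≡any p []       = refl
anyB≡any p (x ∷ xs) = cong (p x ∨_) (anyB≡any p xs)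

anyB-upTo⁺ : ∀ (p : ℕ → Bool) {N k} → k < N → T (p k) → T (anyB p (upTo N))
anyB-upTo⁺ p {N} k<N pk = subst T (sym (anyB≡any p (upTo N))) (any⁺ p (applyUpTo⁺ id pk k<N))

anyB-upTo⁻ : ∀ (p : ℕ → Bool) N → T (anyB p (upTo N)) → ∃[ k ] k < N × T (p k)
anyB-upTo⁻ p N = applyUpTo⁻ id ∘ any⁻ p (upTo N) ∘ subst T (anyB≡any p (upTo N))

H-≗-window : ∀ {n a} c .{{_ : NonZero n}} .{{_ : NonZero a}} → a ∣ n → ∀ x → H n a c x ≡ (toℕ x % a <ᵇ c)
H-≗-window {n} {a} c a∣n x = T-ext to from
  where
  X : ℕ
  X = toℕ x
  same-residue : ∀ r t → (r + t * a) % n ≡ X → r % a ≡ X % a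
  same-residue r t r+ta≡X = begin
    r % a                   ≡⟨ [m+kn]%n≡m%n r t a ⟨
    (r + t * a) % a         ≡⟨ m∣n⇒o%n%m≡o%m a n (r + t * a) a∣n ⟨
    (r + t * a) % n % a     ≡⟨ cong (_% a) r+ta≡X ⟩
    X % a                   ∎
  to : T (H n a c x) → T (X % a <ᵇ c)
  to x∈H with anyB-upTo⁻ _ c x∈H
  ... | r , r<c , x∈r+aℤ with anyB-upTo⁻ _ n x∈r+aℤ
  ... | t , _ , r+ta≡X = <⇒<ᵇ (≤-<-trans (subst (_≤ r) (same-residue r t (≡ᵇ⇒≡ _ X r+ta≡X)) (m%n≤m r a)) r<c)
  from : T (X % a <ᵇ c) → T (H n a c x)
  from X%a<c = anyB-upTo⁺ (λ r → anyB (λ t → (r + t * a) % n ≡ᵇ X) (upTo n)) (<ᵇ⇒< _ c X%a<c)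
                (anyB-upTo⁺ (λ t → (X % a + t * a) % n ≡ᵇ X) (≤-<-trans (m/n≤m X a) (toℕ<n x)) (≡⇒≡ᵇ _ X (begin
    (X % a + X / a * a) % n   ≡⟨ cong (_% n) (m≡m%n+[m/n]*n X a) ⟨
    X % n                     ≡⟨ m<n⇒m%n≡m (toℕ<n x) ⟩
    X                         ∎)))

-- The chunks ch(a_i)

lcm-over : ∀ {A : Set} → (A → Bool) → (A → ℕ) → List A → ℕ
lcm-over p g = List.foldr (λ j acc → if p j then lcm (g j) acc else acc) 1

lcm-over-least : ∀ {A : Set} {p : A → Bool} {g : A → ℕ} {m} → (∀ j → T (p j) → g j ∣ m) → ∀ xs → lcm-over p g xs ∣ m
lcm-over-least                 g∣m []       = 1∣ _
lcm-over-least {p = p} {g} g∣m (x ∷ xs) with p x in px≡true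
... | true  = lcm-least (g∣m x (subst T (sym px≡true) _)) (lcm-over-least {p = p} {g} g∣m xs)
... | false = lcm-over-least {p = p} {g} g∣m xs

∣-lcm-over : ∀ {A : Set} {p : A → Bool} {g : A → ℕ} {j xs} → j ∈ xs → T (p j) → g j ∣ lcm-over p g xs
∣-lcm-over {p = p} {g} {xs = x ∷ xs} (here refl) pj with p x
... | true  = m∣lcm[m,n] (g x) (lcm-over p g xs)
∣-lcm-over {p = p} {g} {xs = x ∷ xs} (there j∈xs) pj with p x
... | true  = ∣-trans (∣-lcm-over {p = p} {g} j∈xs pj) (n∣lcm[m,n] (g x) (lcm-over p g xs))
... | false = ∣-lcm-over {p = p} {g} j∈xs pj

T-∨false⊎T-not : ∀ b → T (b ∨ false) ⊎ T (not b)
T-∨false⊎T-not true  = inj₁ _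
T-∨false⊎T-not false = inj₂ _

module _ {m : ℕ} (a : Fin m → ℕ) (σ : Fin m → Fin m → Bool) where

  ch∣a : ∀ i → ch a σ i ∣ a i
  ch∣a i = lcm-over-least {p = assignedTo σ i} {λ j → gcd (a i) (a j)} (λ j _ → gcd[m,n]∣m (a i) (a j)) (allFin m)

  gcd∣ch : ∀ {i j} → T (assignedTo σ i j) → gcd (a i) (a j) ∣ ch a σ i
  gcd∣ch {i} {j} = ∣-lcm-over {p = assignedTo σ i} {λ k → gcd (a i) (a k)} (∈-allFin j)

  assigned-either : ∀ {i j} → i ≢ j → T (assignedTo σ i j) ⊎ T (assignedTo σ j i)
  assigned-either {i} {j} i≢j with <-cmp (toℕ i) (toℕ j)
  ... | tri≈ _ i≡j _ = contradiction (toℕ-injective i≡j) i≢j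
  ... | tri< i<j _ j≮i rewrite dec-true (toℕ i <? toℕ j) i<j | dec-false (toℕ j <? toℕ i) j≮i = T-∨false⊎T-not (σ i j)
  ... | tri> i≮j _ j<i rewrite dec-false (toℕ i <? toℕ j) i≮j | dec-true (toℕ j <? toℕ i) j<i = swap (T-∨false⊎T-not (σ j i))

  gcd∣ch-either : ∀ {i j} → i ≢ j → gcd (a i) (a j) ∣ ch a σ i ⊎ gcd (a i) (a j) ∣ ch a σ j
  gcd∣ch-either {i} {j} i≢j with assigned-either i≢j
  ... | inj₁ i-assigned = inj₁ (gcd∣ch i-assigned)
  ... | inj₂ j-assigned = inj₂ (subst (_∣ ch a σ j) (gcd-comm (a j) (a i)) (gcd∣ch j-assigned))

-- Multiplicities in Δ(H_i, H_j)

∣-nonZero : ∀ {m n} .{{_ : NonZero n}} → m ∣ n → NonZero m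
∣-nonZero {zero}  {n} (divides q n≡q*0) = contradiction (trans n≡q*0 (*-zeroʳ q)) (≢-nonZero⁻¹ n)
∣-nonZero {suc m}     _                 = _

Δcount-H : ∀ {n a b c d} .{{_ : NonZero n}} .{{_ : NonZero a}} .{{_ : NonZero b}} → a ∣ n → b ∣ n → ∀ z →
           Δcount n (H n a c) (H n b d) z ≡ #[ y < n ] (((y + toℕ z) % a <ᵇ c) ∧ ((y + 0) % b <ᵇ d))
Δcount-H {n} {a} {b} {c} {d} a∣n b∣n z =
  trans (Δcount-≡-# (λ x → x % a <ᵇ c) (λ y → y % b <ᵇ d) (H-≗-window c a∣n) (H-≗-window d b∣n) z)
        (∑-cong n (λ y _ → cong 𝟙 (cong₂ _∧_ (cong (_<ᵇ c) (m∣n⇒o%n%m≡o%m a n (y + toℕ z) a∣n))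
                                             (cong (λ t → t % b <ᵇ d) (sym (+-identityʳ y))))))

Δcount-H-scaled : ∀ {n a b c d} .{{_ : NonZero n}} .{{_ : NonZero a}} .{{_ : NonZero b}} → a ∣ n → b ∣ n →
                  c ≤ a → d ≤ b → gcd a b ∣ c ⊎ gcd a b ∣ d →
                  ∀ z → Δcount n (H n a c) (H n b d) z * (a * b) ≡ n * c * d
Δcount-H-scaled {c = c} {d} a∣n b∣n c≤a d≤b g∣c⊎g∣d z =
  trans (cong (_* _) (Δcount-H {c = c} {d} a∣n b∣n z))
        ([ (λ g∣c → count-window∧window (toℕ z) 0 a∣n b∣n g∣c c≤a d≤b)
         , (λ g∣d → count-window∧window′ (toℕ z) 0 a∣n b∣n g∣d c≤a d≤b) ] g∣c⊎g∣d)

rescale : ∀ {n a b} .{{_ : NonZero n}} (a∣n : a ∣ n) (b∣n : b ∣ n) c d Δ →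
          Δ * (a * b) ≡ n * c * d → Δ * n ≡ quotient a∣n * c * (quotient b∣n * d)
rescale {n} {a} {b} (divides qa n≡qa*a) (divides qb n≡qb*b) c d Δ Δab≡ncd =
  *-cancelˡ-≡ (Δ * n) (qa * c * (qb * d)) n (begin
  n * (Δ * n)                 ≡⟨ solve 2 (λ n Δ → n :* (Δ :* n) := Δ :* (n :* n)) refl n Δ ⟩
  Δ * (n * n)                 ≡⟨ cong₂ (λ s t → Δ * (s * t)) n≡qa*a n≡qb*b ⟩
  Δ * (qa * a * (qb * b))     ≡⟨ solve 5 (λ Δ qa a qb b → Δ :* (qa :* a :* (qb :* b)) := qa :* qb :* (Δ :* (a :* b)))
                                         refl Δ qa a qb b ⟩
  qa * qb * (Δ * (a * b))     ≡⟨ cong (qa * qb *_) Δab≡ncd ⟩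
  qa * qb * (n * c * d)       ≡⟨ solve 5 (λ qa qb n c d → qa :* qb :* (n :* c :* d) := n :* (qa :* c :* (qb :* d)))
                                         refl qa qb n c d ⟩
  n * (qa * c * (qb * d))     ∎)

Δcount-H-multiplicity : ∀ {n a b c d} .{{_ : NonZero n}} .{{_ : NonZero a}} .{{_ : NonZero b}} (a∣n : a ∣ n) (b∣n : b ∣ n) →
                        c ≤ a → d ≤ b → gcd a b ∣ c ⊎ gcd a b ∣ d →
                        ∀ z → Δcount n (H n a c) (H n b d) z * n ≡ quotient a∣n * c * (quotient b∣n * d)
Δcount-H-multiplicity {n} {a} {b} {c} {d} a∣n b∣n c≤a d≤b g∣c⊎g∣d z =
  rescale a∣n b∣n c d (Δcount n (H n a c) (H n b d) z) (Δcount-H-scaled a∣n b∣n c≤a d≤b g∣c⊎g∣d z)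

theorem4p9 : (n m : ℕ) .{{_ : NonZero n}} (a : Fin m → ℕ) →
  Injective _≡_ _≡_ a → (div : ∀ i → a i ∣ n) →
  (σ : Fin m → Fin m → Bool) →
  IsGPSEDF n m (λ i → H n (a i) (ch a σ i)) (λ i → quotient (div i) * ch a σ i)
  × (∀ i j → i ≢ j → ∀ z →
       Δcount n (H n (a i) (ch a σ i)) (H n (a j) (ch a σ j)) z * (a i * a j)
         ≡ n * ch a σ i * ch a σ j)
theorem4p9 n m a _ div σ = (card-H , multiplicity) , scaled-multiplicity
  where
  instance
    a-nonZero : ∀ {i} → NonZero (a i)
    a-nonZero {i} = ∣-nonZero (div i)
  ch≤a : ∀ i → ch a σ i ≤ a i
  ch≤a i = ∣⇒≤ (ch∣a a σ i)
  card-H : ∀ i → card (H n (a i) (ch a σ i)) ≡ quotient (div i) * ch a σ i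
  card-H i = trans (countB-allFin _ (H-≗-window (ch a σ i) (div i))) (#-window (div i) (ch≤a i))
  multiplicity : ∀ i j → i ≢ j → ∀ z → Δcount n (H n (a i) (ch a σ i)) (H n (a j) (ch a σ j)) z * n
                                         ≡ quotient (div i) * ch a σ i * (quotient (div j) * ch a σ j)
  multiplicity i j i≢j = Δcount-H-multiplicity (div i) (div j) (ch≤a i) (ch≤a j) (gcd∣ch-either a σ i≢j)
  scaled-multiplicity : ∀ i j → i ≢ j → ∀ z → Δcount n (H n (a i) (ch a σ i)) (H n (a j) (ch a σ j)) z * (a i * a j)
                                                ≡ n * ch a σ i * ch a σ j
  scaled-multiplicity i j i≢j = Δcount-H-scaled (div i) (div j) (ch≤a i) (ch≤a j) (gcd∣ch-either a σ i≢j)
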